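{- Let NJ$\epsilon$ and IPC$\epsilon$ be the two deductive systems described in the context. A sequent $\Gamma\Rightarrow A$ is provable in NJ$\epsilon$ if and only if it is provable in IPC$\epsilon$.
   Context: Language: a first-order predicate language with predicate symbols, individual variables and individual constants (no other function symbols), connectives $\&,\vee,\to,\bot$ and quantifiers $\forall,\exists$. Terms and formulas are defined simultaneously: variables and constants are terms; atomic formulas and composite formulas are formed as usual; and if $A(x)$ is a formula then $\epsilon xA(x)$ is a term (in which $x$ is bound). All substitutions are assumed safe (no free variable becomes bound). For a term $t$ the formula $t\downarrow$ ("$t$ is defined") is: $\top$ (the constant true, e.g. $\bot\to\bot$) if $t$ is a variable or a constant; and $\exists y(\exists xA(x)\to A(y))$ if $t=\epsilon xA(x)$. A sequent $\Gamma\Rightarrow G$ consists of a finite set of formulas $\Gamma$ and a formula $G$. IPC$\epsilon$ (Gentzen-style): axioms $\Gamma,A\Rightarrow A$ and $\Gamma,\bot\Rightarrow A$; the usual intuitionistic sequent rules for $\&,\vee,\to$ (left and right); $\Rightarrow\forall$: from $\Gamma\Rightarrow A(b)$ infer $\Gamma\Rightarrow\forall xA(x)$ ($b$ a variable not free in the conclusion); cut: from $\Gamma\Rightarrow C$ and $C,\Gamma\Rightarrow G$ infer $\Gamma\Rightarrow G$; and the modified quantifier rules: $\forall\Rightarrow$: from $\Gamma\Rightarrow t\downarrow$ and $F(t),\Delta\Rightarrow G$ infer $\forall zF(z),\Gamma,\Delta\Rightarrow G$; $\Rightarrow\exists$: from $\Gamma\Rightarrow t\downarrow$ and $\Gamma\Rightarrow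 F(t)$ infer $\Gamma\Rightarrow\exists zF(z)$; $\exists_\epsilon\Rightarrow$: from $A(\epsilon xA(x)),\Gamma\Rightarrow G$ infer $\exists xA(x),\Gamma\Rightarrow G$. NJ$\epsilon$ (natural deduction, written with sequents $A_1,\dots,A_n\Rightarrow A$ meaning $A$ is deducible from assumptions $A_1,\dots,A_n$): axioms and propositional rules as in ordinary intuitionistic natural deduction, $\forall$-introduction as usual (with eigenvariable condition), and additionally: existential instantiation: from $\Gamma\Rightarrow\exists xF(x)$ infer $\Gamma\Rightarrow F(\epsilon xF(x))$; $\forall$-elimination: from $\Gamma\Rightarrow t\downarrow$ and $\Delta\Rightarrow\forall zF(z)$ infer $\Gamma,\Delta\Rightarrow F(t)$; $\exists$-introduction: from $\Gamma\Rightarrow t\downarrow$ and $\Delta\Rightarrow F(t)$ infer $\Gamma,\Delta\Rightarrow\exists zF(z)$. -}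

module Defs where

open import Data.Nat using (ℕ; zero; suc)
open import Data.List using (List; []; _∷_; _++_; map)
open import Data.List.Membership.Propositional using (_∈_)
open import Data.List.Relation.Binary.BagAndSetEquality using (_∼[_]_; set)

-- Syntax of the ε-language, with de Bruijn indices for individual
-- variables (so every substitution is automatically capture-free,
-- i.e. "safe").  Constants and predicate symbols are named by ℕ.
mutual
  data Term : Set where
    var : ℕ → Term
    con : ℕ → Term
    eps : Formula → Term      -- ε x A(x); binds index 0 of A

  data Formula : Set where
    atom : ℕ → List Term → Formula
    _&_  : Formula → Formula → Formula
    _∨_  : Formula → Formula → Formula
    _⊃_  : Formula → Formula → Formula
    ⊥̇    : Formula
    ∀̇    : Formula → Formula
    ∃̇    : Formula → Formula

infixr 6 _&_
infixr 5 _∨_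
infixr 4 _⊃_

liftR : (ℕ → ℕ) → ℕ → ℕ
liftR ρ zero    = zero
liftR ρ (suc n) = suc (ρ n)

mutual
  renT : (ℕ → ℕ) → Term → Term
  renT ρ (var n) = var (ρ n)
  renT ρ (con c) = con c
  renT ρ (eps A) = eps (renF (liftR ρ) A)

  renTs : (ℕ → ℕ) → List Term → List Term
  renTs ρ []       = []
  renTs ρ (t ∷ ts) = renT ρ t ∷ renTs ρ ts

  renF : (ℕ → ℕ) → Formula → Formula
  renF ρ (atom P ts) = atom P (renTs ρ ts)
  renF ρ (A & B)     = renF ρ A & renF ρ B
  renF ρ (A ∨ B)     = renF ρ A ∨ renF ρ B
  renF ρ (A ⊃ B)     = renF ρ A ⊃ renF ρ B
  renF ρ ⊥̇           = ⊥̇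
  renF ρ (∀̇ A)       = ∀̇ (renF (liftR ρ) A)
  renF ρ (∃̇ A)       = ∃̇ (renF (liftR ρ) A)

-- shift all free variables up by one (used for a fresh eigenvariable)
shiftF : Formula → Formula
shiftF = renF suc

liftS : (ℕ → Term) → ℕ → Term
liftS σ zero    = var zero
liftS σ (suc n) = renT suc (σ n)

mutual
  subT : (ℕ → Term) → Term → Term
  subT σ (var n) = σ n
  subT σ (con c) = con c
  subT σ (eps A) = eps (subF (liftS σ) A)

  subTs : (ℕ → Term) → List Term → List Term
  subTs σ []       = []
  subTs σ (t ∷ ts) = subT σ t ∷ subTs σ ts

  subF : (ℕ → Term) → Formula → Formula
  subF σ (atom P ts) = atom P (subTs σ ts)
  subF σ (A & B)     = subF σ A & subF σ B
  subF σ (A ∨ B)     = subF σ A ∨ subF σ B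
  subF σ (A ⊃ B)     = subF σ A ⊃ subF σ B
  subF σ ⊥̇           = ⊥̇
  subF σ (∀̇ A)       = ∀̇ (subF (liftS σ) A)
  subF σ (∃̇ A)       = ∃̇ (subF (liftS σ) A)

single : Term → ℕ → Term
single t zero    = t
single t (suc n) = var n

-- F [ t ] : for the body F of a binder ∀z F(z) / ∃z F(z) / ε z F(z),
-- this is F(t).
_[_] : Formula → Term → Formula
F [ t ] = subF (single t) F

⊤̇ : Formula
⊤̇ = ⊥̇ ⊃ ⊥̇

-- t↓ :  ⊤ for variables and constants,
--        ∃y(∃x A(x) → A(y)) for t = ε x A(x)
_↓ : Term → Formula
var _ ↓ = ⊤̇
con _ ↓ = ⊤̇
eps A ↓ = ∃̇ (∃̇ (renF (liftR suc) A) ⊃ A)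

Ctx : Set
Ctx = List Formula

-- Antecedents are finite SETS of formulas; we represent them by lists and
-- identify lists with the same elements via the structural rule `reorg`.

data IPCε : Ctx → Formula → Set where
  reorg : ∀ {Γ Γ' G} → Γ ∼[ set ] Γ' → IPCε Γ G → IPCε Γ' G
  ax    : ∀ {Γ A} → IPCε (A ∷ Γ) A
  ax⊥   : ∀ {Γ A} → IPCε (⊥̇ ∷ Γ) A
  &⇒    : ∀ {Γ A B G} → IPCε (A ∷ B ∷ Γ) G → IPCε ((A & B) ∷ Γ) G
  ⇒&    : ∀ {Γ A B} → IPCε Γ A → IPCε Γ B → IPCε Γ (A & B)
  ∨⇒    : ∀ {Γ A B G} → IPCε (A ∷ Γ) G → IPCε (B ∷ Γ) G → IPCε ((A ∨ B) ∷ Γ) G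
  ⇒∨₁   : ∀ {Γ A B} → IPCε Γ A → IPCε Γ (A ∨ B)
  ⇒∨₂   : ∀ {Γ A B} → IPCε Γ B → IPCε Γ (A ∨ B)
  ⊃⇒    : ∀ {Γ A B G} → IPCε Γ A → IPCε (B ∷ Γ) G → IPCε ((A ⊃ B) ∷ Γ) G
  ⇒⊃    : ∀ {Γ A B} → IPCε (A ∷ Γ) B → IPCε Γ (A ⊃ B)
  ⇒∀    : ∀ {Γ A} → IPCε (map shiftF Γ) A → IPCε Γ (∀̇ A)
  cut   : ∀ {Γ C G} → IPCε Γ C → IPCε (C ∷ Γ) G → IPCε Γ G
  ∀⇒    : ∀ {Γ Δ F G} (t : Term) → IPCε Γ (t ↓) → IPCε (F [ t ] ∷ Δ) G →
          IPCε (∀̇ F ∷ Γ ++ Δ) G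
  ⇒∃    : ∀ {Γ F} (t : Term) → IPCε Γ (t ↓) → IPCε Γ (F [ t ]) → IPCε Γ (∃̇ F)
  ∃ε⇒   : ∀ {Γ A G} → IPCε (A [ eps A ] ∷ Γ) G → IPCε (∃̇ A ∷ Γ) G

data NJε : Ctx → Formula → Set where
  reorg : ∀ {Γ Γ' G} → Γ ∼[ set ] Γ' → NJε Γ G → NJε Γ' G
  ax    : ∀ {Γ A} → NJε (A ∷ Γ) A
  ⊥E    : ∀ {Γ A} → NJε Γ ⊥̇ → NJε Γ A
  &I    : ∀ {Γ Δ A B} → NJε Γ A → NJε Δ B → NJε (Γ ++ Δ) (A & B)
  &E₁   : ∀ {Γ A B} → NJε Γ (A & B) → NJε Γ A
  &E₂   : ∀ {Γ A B} → NJε Γ (A & B) → NJε Γ B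
  ∨I₁   : ∀ {Γ A B} → NJε Γ A → NJε Γ (A ∨ B)
  ∨I₂   : ∀ {Γ A B} → NJε Γ B → NJε Γ (A ∨ B)
  ∨E    : ∀ {Γ Δ Θ A B C} → NJε Γ (A ∨ B) → NJε (A ∷ Δ) C → NJε (B ∷ Θ) C →
          NJε (Γ ++ Δ ++ Θ) C
  ⊃I    : ∀ {Γ A B} → NJε (A ∷ Γ) B → NJε Γ (A ⊃ B)
  ⊃E    : ∀ {Γ Δ A B} → NJε Γ (A ⊃ B) → NJε Δ A → NJε (Γ ++ Δ) B
  ∀I    : ∀ {Γ A} → NJε (map shiftF Γ) A → NJε Γ (∀̇ A)
  ∃inst : ∀ {Γ F} → NJε Γ (∃̇ F) → NJε Γ (F [ eps F ])
  ∀E    : ∀ {Γ Δ F} (t : Term) → NJε Γ (t ↓) → NJε Δ (∀̇ F) → NJε (Γ ++ Δ) (F [ t ])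
  ∃I    : ∀ {Γ Δ F} (t : Term) → NJε Γ (t ↓) → NJε Δ (F [ t ]) → NJε (Γ ++ Δ) (∃̇ F)

-- Introduction rules of NJε are the right rules of IPCε and vice versa; an
-- elimination rule of NJε becomes a cut on its major premise followed by the
-- corresponding left rule, and a left rule of IPCε becomes an elimination
-- applied to the principal assumption, followed by a cut.  The only mismatch
-- is in the bookkeeping of antecedents: NJε joins the contexts of premises
-- (Γ ++ Δ), whereas IPCε shares them and places the principal formula of a
-- left rule at the head.  So we first show that both calculi admit weakening
-- along an inclusion of contexts (for IPCε by induction on derivations, for
-- NJε directly from ⊃I/⊃E), and that NJε admits cut (a ⊃-detour); together
-- with the set-equality rule 'reorg' this absorbs every difference.

module Submission where

open import Defs
open import Function.Base using (_∘_)
open import Function.Bundles using (_⇔_; mk⇔; Equivalence)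
open import Data.List using ([]; _∷_; _++_)
open import Data.List.Membership.Propositional using (_∈_)
open import Data.List.Membership.Propositional.Properties using (∈-++⁻)
open import Data.List.Relation.Binary.BagAndSetEquality
  using (_∼[_]_; set; ∷-cong; ++-idempotent)
open import Data.List.Relation.Binary.Subset.Propositional using (_⊆_)
open import Data.List.Relation.Binary.Subset.Propositional.Properties
  using (⊆-refl; xs⊆x∷xs; ∷⁺ʳ; ∈-∷⁺ʳ; xs⊆xs++ys; xs⊆ys++xs; map⁺)
open import Data.List.Relation.Unary.Any using (here; there)
open import Data.Sum using ([_,_]′)
open import Relation.Binary.PropositionalEquality using (refl)

⊆-antisym : ∀ {Γ Γ' : Ctx} → Γ ⊆ Γ' → Γ' ⊆ Γ → Γ ∼[ set ] Γ'
⊆-antisym Γ⊆Γ' Γ'⊆Γ = mk⇔ Γ⊆Γ' Γ'⊆Γ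

++-lub : ∀ {Γ Δ X : Ctx} → Γ ⊆ X → Δ ⊆ X → Γ ++ Δ ⊆ X
++-lub {Γ} Γ⊆X Δ⊆X = [ Γ⊆X , Δ⊆X ]′ ∘ ∈-++⁻ Γ

absorb : ∀ {A : Formula} {X : Ctx} → A ∈ X → (A ∷ X) ∼[ set ] X
absorb {A} {X} A∈X = ⊆-antisym (∈-∷⁺ʳ A∈X ⊆-refl) (xs⊆x∷xs X A)

∀⇒-shared : ∀ {Γ F G} (t : Term) → IPCε Γ (t ↓) → IPCε (F [ t ] ∷ Γ) G →
            IPCε (∀̇ F ∷ Γ) G
∀⇒-shared {Γ} t d e = reorg (∷-cong refl (++-idempotent Γ)) (∀⇒ t d e)

-- Weakening along an inclusion of contexts.  A left rule whose principal
-- formula A lies in the larger context X is applied to A ∷ X and A is then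
-- absorbed into X.
weakenIPCε : ∀ {Γ X A} → IPCε Γ A → Γ ⊆ X → IPCε X A
weakenIPCε (reorg eq d) s = weakenIPCε d (s ∘ Equivalence.to eq)
weakenIPCε ax         s = reorg (absorb (s (here refl))) ax
weakenIPCε ax⊥        s = reorg (absorb (s (here refl))) ax⊥
weakenIPCε (&⇒ d)     s = reorg (absorb (s (here refl)))
  (&⇒ (weakenIPCε d (∷⁺ʳ _ (∷⁺ʳ _ (s ∘ there)))))
weakenIPCε (⇒& d e)   s = ⇒& (weakenIPCε d s) (weakenIPCε e s)
weakenIPCε (∨⇒ d e)   s = reorg (absorb (s (here refl)))
  (∨⇒ (weakenIPCε d (∷⁺ʳ _ (s ∘ there))) (weakenIPCε e (∷⁺ʳ _ (s ∘ there))))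
weakenIPCε (⇒∨₁ d)    s = ⇒∨₁ (weakenIPCε d s)
weakenIPCε (⇒∨₂ d)    s = ⇒∨₂ (weakenIPCε d s)
weakenIPCε (⊃⇒ d e)   s = reorg (absorb (s (here refl)))
  (⊃⇒ (weakenIPCε d (s ∘ there)) (weakenIPCε e (∷⁺ʳ _ (s ∘ there))))
weakenIPCε (⇒⊃ d)     s = ⇒⊃ (weakenIPCε d (∷⁺ʳ _ s))
weakenIPCε (⇒∀ d)     s = ⇒∀ (weakenIPCε d (map⁺ shiftF s))
weakenIPCε (cut d e)  s = cut (weakenIPCε d s) (weakenIPCε e (∷⁺ʳ _ s))
weakenIPCε (∀⇒ {Γ} {Δ} t d e) s = reorg (absorb (s (here refl)))
  (∀⇒-shared t (weakenIPCε d (s ∘ there ∘ xs⊆xs++ys Γ Δ))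
               (weakenIPCε e (∷⁺ʳ _ (s ∘ there ∘ xs⊆ys++xs Δ Γ))))
weakenIPCε (⇒∃ t d e) s = ⇒∃ t (weakenIPCε d s) (weakenIPCε e s)
weakenIPCε (∃ε⇒ d)    s = reorg (absorb (s (here refl)))
  (∃ε⇒ (weakenIPCε d (∷⁺ʳ _ (s ∘ there))))

-- Weakening by one formula B: apply  A ⊃ A, derived under the idle
-- assumption B, to the given derivation of A.
weaken₁NJε : ∀ {Γ A B} → NJε Γ A → NJε (B ∷ Γ) A
weaken₁NJε {B = B} d = ⊃E (⊃I (ax {Γ = B ∷ []})) d

prependNJε : ∀ Δ {Γ A} → NJε Γ A → NJε (Δ ++ Γ) A
prependNJε []      d = d
prependNJε (_ ∷ Δ) d = weaken₁NJε (prependNJε Δ d)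

weakenNJε : ∀ {Γ X A} → NJε Γ A → Γ ⊆ X → NJε X A
weakenNJε {Γ} {X} d s =
  reorg (⊆-antisym (++-lub ⊆-refl s) (xs⊆xs++ys X Γ)) (prependNJε X d)

-- Cut, as the detour ⊃E (⊃I e) d followed by contraction of Γ ++ Γ.
cutNJε : ∀ {Γ C G} → NJε Γ C → NJε (C ∷ Γ) G → NJε Γ G
cutNJε {Γ} d e = reorg (++-idempotent Γ) (⊃E (⊃I e) d)

assumption : ∀ {Γ A} → A ∈ Γ → NJε Γ A
assumption A∈Γ = weakenNJε ax (∈-∷⁺ʳ A∈Γ ⊆-refl)

inLeft : ∀ {Γ Δ A} → IPCε Γ A → IPCε (Γ ++ Δ) A
inLeft {Γ} {Δ} d = weakenIPCε d (xs⊆xs++ys Γ Δ)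

inRight : ∀ {Γ Δ A} → IPCε Δ A → IPCε (Γ ++ Δ) A
inRight {Γ} {Δ} d = weakenIPCε d (xs⊆ys++xs Δ Γ)

-- Introductions are right rules; an elimination cuts its major premise
-- against the matching left rule (with an axiom as its minor premise).
NJε⇒IPCε : ∀ {Γ A} → NJε Γ A → IPCε Γ A
NJε⇒IPCε (reorg eq d)  = reorg eq (NJε⇒IPCε d)
NJε⇒IPCε ax            = ax
NJε⇒IPCε (⊥E d)        = cut (NJε⇒IPCε d) ax⊥
NJε⇒IPCε (&I d e)      = ⇒& (inLeft (NJε⇒IPCε d)) (inRight (NJε⇒IPCε e))
NJε⇒IPCε (&E₁ d)       = cut (NJε⇒IPCε d) (&⇒ ax)
NJε⇒IPCε (&E₂ d)       =
  cut (NJε⇒IPCε d) (&⇒ (weakenIPCε ax (∈-∷⁺ʳ (there (here refl)) ⊆-refl)))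
NJε⇒IPCε (∨I₁ d)       = ⇒∨₁ (NJε⇒IPCε d)
NJε⇒IPCε (∨I₂ d)       = ⇒∨₂ (NJε⇒IPCε d)
NJε⇒IPCε (∨E {Γ} d e f) =
  cut (inLeft (NJε⇒IPCε d))
      (∨⇒ (weakenIPCε (NJε⇒IPCε e) (∷⁺ʳ _ (xs⊆ys++xs _ Γ ∘ xs⊆xs++ys _ _)))
          (weakenIPCε (NJε⇒IPCε f) (∷⁺ʳ _ (xs⊆ys++xs _ Γ ∘ xs⊆ys++xs _ _))))
NJε⇒IPCε (⊃I d)        = ⇒⊃ (NJε⇒IPCε d)
NJε⇒IPCε (⊃E d e)      = cut (inLeft (NJε⇒IPCε d)) (⊃⇒ (inRight (NJε⇒IPCε e)) ax)
NJε⇒IPCε (∀I d)        = ⇒∀ (NJε⇒IPCε d)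
NJε⇒IPCε (∃inst d)     = cut (NJε⇒IPCε d) (∃ε⇒ ax)
NJε⇒IPCε (∀E t d e)    =
  cut (inRight (NJε⇒IPCε e)) (∀⇒-shared t (inLeft (NJε⇒IPCε d)) ax)
NJε⇒IPCε (∃I t d e)    = ⇒∃ t (inLeft (NJε⇒IPCε d)) (inRight (NJε⇒IPCε e))

-- Cut a derived formula B into a derivation whose assumptions lie among B ∷ Γ;
-- this simulates a left rule, B being obtained from the principal assumption
-- by an elimination.
cutInto : ∀ {Γ Δ B G} → NJε Γ B → NJε Δ G → Δ ⊆ B ∷ Γ → NJε Γ G
cutInto d e s = cutNJε d (weakenNJε e s)

-- Right rules are introductions (contracting Γ ++ Γ where the premises share
-- Γ); left rules eliminate the principal assumption and cut the result in.
IPCε⇒NJε : ∀ {Γ A} → IPCε Γ A → NJε Γ A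
IPCε⇒NJε (reorg eq d) = reorg eq (IPCε⇒NJε d)
IPCε⇒NJε ax           = ax
IPCε⇒NJε ax⊥          = ⊥E ax
IPCε⇒NJε (&⇒ d)       =
  cutInto (&E₁ ax)
          (cutInto (&E₂ (assumption (there (here refl)))) (IPCε⇒NJε d)
                   (∈-∷⁺ʳ (there (here refl)) (∈-∷⁺ʳ (here refl) (there ∘ there ∘ there))))
          ⊆-refl
IPCε⇒NJε (⇒& {Γ} d e) = reorg (++-idempotent Γ) (&I (IPCε⇒NJε d) (IPCε⇒NJε e))
IPCε⇒NJε (∨⇒ d e)     =
  weakenNJε (∨E (ax {Γ = []}) (IPCε⇒NJε d) (IPCε⇒NJε e))
            (∈-∷⁺ʳ (here refl) (++-lub there there))
IPCε⇒NJε (⇒∨₁ d)      = ∨I₁ (IPCε⇒NJε d)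
IPCε⇒NJε (⇒∨₂ d)      = ∨I₂ (IPCε⇒NJε d)
IPCε⇒NJε (⊃⇒ d e)     = cutInto (⊃E (ax {Γ = []}) (IPCε⇒NJε d)) (IPCε⇒NJε e) (∷⁺ʳ _ there)
IPCε⇒NJε (⇒⊃ d)       = ⊃I (IPCε⇒NJε d)
IPCε⇒NJε (⇒∀ d)       = ∀I (IPCε⇒NJε d)
IPCε⇒NJε (cut d e)    = cutNJε (IPCε⇒NJε d) (IPCε⇒NJε e)
IPCε⇒NJε (∀⇒ {Γ} {Δ} t d e) =
  cutInto (weakenNJε (∀E t (IPCε⇒NJε d) (ax {Γ = []}))
                     (++-lub (there ∘ xs⊆xs++ys Γ Δ) (∈-∷⁺ʳ (here refl) (λ ()))))
          (IPCε⇒NJε e) (∷⁺ʳ _ (there ∘ xs⊆ys++xs Δ Γ))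
IPCε⇒NJε (⇒∃ {Γ} t d e) = reorg (++-idempotent Γ) (∃I t (IPCε⇒NJε d) (IPCε⇒NJε e))
IPCε⇒NJε (∃ε⇒ d)      = cutInto (∃inst ax) (IPCε⇒NJε d) (∷⁺ʳ _ there)

mainTheorem1 : (Γ : Ctx) (A : Formula) → NJε Γ A ⇔ IPCε Γ A
mainTheorem1 Γ A = mk⇔ NJε⇒IPCε IPCε⇒NJε
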